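{- Let $S=\{0,1,2\}$ and $s_0=0$. If a $k$-colouring $\varphi$ of $\mathbb{Z}$ contains no almost-monochromatic positive homothet of $(S,s_0)$ (i.e. there are no $a\in\mathbb{Z}$, $t\in\mathbb{N}$ with $\varphi(a+t)=\varphi(a+2t)\neq\varphi(a)$), then every colour class of $\varphi$ is a two-way infinite arithmetic progression $\{a+it: i\in\mathbb{Z}\}$ with $t\in\mathbb{N}$. Moreover, there is $F=F(k)\in\mathbb{N}$, depending only on $k$, such that every such $\varphi$ is periodic with period $F$, i.e. $\varphi(n+F)=\varphi(n)$ for all $n\in\mathbb{Z}$.
   Context: A $k$-colouring uses at most $k$ colours; colour classes are the nonempty preimages of colours. -}

module Defs where

open import Data.Nat using (ℕ; _≤_)
open import Data.Integer using (ℤ; +_; _+_; _*_)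
open import Data.Fin using (Fin)
open import Data.Product using (Σ; _×_; ∃)
open import Relation.Binary.PropositionalEquality using (_≡_; _≢_)
open import Relation.Nullary using (¬_)
open import Function.Bundles using (_⇔_)

Colouring : ℕ → Set
Colouring k = ℤ → Fin k

HasAlmostMonoHomothet : ∀ {k} → Colouring k → Set
HasAlmostMonoHomothet φ =
  Σ ℤ λ a → Σ ℕ λ t → (1 ≤ t) ×
    (φ (a + + t) ≡ φ (a + + 2 * + t)) × (φ (a + + t) ≢ φ a)

IsTwoWayAP : (ℤ → Set) → Set
IsTwoWayAP P = Σ ℤ λ a → Σ ℕ λ t → (1 ≤ t) ×
  (∀ m → P m ⇔ (Σ ℤ λ i → m ≡ a + i * + t))

ColourClass : ∀ {k} → Colouring k → Fin k → ℤ → Set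
ColourClass φ c n = φ n ≡ c

Periodic : ∀ {k} → Colouring k → ℕ → Set
Periodic φ F = ∀ n → φ (n + + F) ≡ φ n

-- Let φ avoid every pattern φ(a+t) = φ(a+2t) ≠ φ(a) with t ≥ 1.  The basic
-- observation is that a repetition φ(x+d) = φ(x) then propagates downwards:
-- φ(x - md) = φ(x) for every m ∈ ℕ (at y = x - d, the values φ(y+d), φ(y+2d)
-- agree, so φ(y) must agree with them too).
--
-- We build k+1 offsets a₀ < … < a_k, all dividing
-- F = (bound k)!, such that every gap aⱼ - aᵢ divides aᵢ.  For any p, two of
-- the k+1 points p + aᵢ share a colour (pigeonhole); walking down from
-- p + aᵢ by the gap aⱼ - aᵢ reaches p, so φ(p + aᵢ) = φ(p).  Applied at
-- p = n + F and walking down by aᵢ ∣ F, this gives φ(n + F) = φ(n).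
--
-- For a periodic φ a repetition at distance d also spreads
-- upwards, so it fills all of x + dℤ.  Taking a colour-c repetition at a
-- minimal distance s (found by well-founded descent, the candidate steps
-- being decidable thanks to periodicity), the class of c is exactly x + sℤ.

module Submission where

open import Defs
open import Data.Nat using (ℕ; zero; suc; _≤_; _<_; _∸_; _!; z≤n; s≤s)
  renaming (_+_ to _+ℕ_; _*_ to _*ℕ_)
import Data.Nat.Properties as ℕP
open import Data.Nat.Divisibility using (_∣_; divides; m≤n⇒m!∣n!; ∣-trans; ∣m∣n⇒∣m+n)
open import Data.Nat.Induction using (<-rec)
open import Data.Integer using (ℤ; +_; -[1+_]; _+_; _*_; _-_; -_)
import Data.Integer.Properties as ℤP
open import Data.Integer.DivMod using (_%ℕ_; _/ℕ_; n%ℕd<d; a≡a%ℕn+[a/ℕn]*n)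
open import Data.Integer.Tactic.RingSolver using (solve-∀)
open import Data.Fin using (Fin; zero; suc; toℕ; _≟_)
import Data.Fin.Properties as FinP
open import Data.Product using (Σ; ∃; _×_; _,_)
open import Data.Empty using (⊥-elim)
open import Relation.Binary.PropositionalEquality
open import Relation.Nullary using (¬_; Dec; yes; no)
open import Relation.Nullary.Decidable using (_×-dec_)
open import Function.Bundles using (mk⇔)

open ≡-Reasoning

add-sub-cancel : ∀ p u → p + u - u ≡ p
add-sub-cancel = solve-∀

add-zero-multiple : ∀ x d → x + + 0 * d ≡ x
add-zero-multiple = solve-∀

sub-zero-multiple : ∀ x d → x - + 0 * d ≡ x
sub-zero-multiple = solve-∀

add-negated : ∀ x z d → x + (- z) * d ≡ x - z * d
add-negated = solve-∀

∣n! : ∀ {m n} → 1 ≤ m → m ≤ n → m ∣ n !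
∣n! {suc m} _ m≤n =
  ∣-trans (divides (m !) (ℕP.*-comm (suc m) (m !))) (m≤n⇒m!∣n! m≤n)

-- bound n is an upper bound for the n+1 offsets of level n.
bound : ℕ → ℕ
bound zero    = 1
bound (suc n) = bound n ! +ℕ bound n

offset : (n : ℕ) → Fin (suc n) → ℕ
offset zero    zero    = 1
offset (suc n) zero    = bound n !
offset (suc n) (suc i) = bound n ! +ℕ offset n i

offset-pos : ∀ n i → 1 ≤ offset n i
offset-pos zero    zero    = s≤s z≤n
offset-pos (suc n) zero    = ℕP.1≤n! (bound n)
offset-pos (suc n) (suc i) = ℕP.≤-trans (offset-pos n i) (ℕP.m≤n+m (offset n i) (bound n !))

offset-≤-bound : ∀ n i → offset n i ≤ bound n
offset-≤-bound zero    zero    = ℕP.≤-refl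
offset-≤-bound (suc n) zero    = ℕP.m≤m+n (bound n !) (bound n)
offset-≤-bound (suc n) (suc i) = ℕP.+-monoʳ-≤ (bound n !) (offset-≤-bound n i)

offset-∣-period : ∀ n i → offset n i ∣ bound n !
offset-∣-period n i = ∣n! (offset-pos n i) (offset-≤-bound n i)

offset-mono : ∀ n (i j : Fin (suc n)) → toℕ i < toℕ j → offset n i < offset n j
offset-mono (suc n) zero    (suc j) _         = ℕP.m<m+n (bound n !) (offset-pos n j)
offset-mono (suc n) (suc i) (suc j) (s≤s i<j) = ℕP.+-monoʳ-< (bound n !) (offset-mono n i j i<j)

-- Gaps from the
-- first offset are at most N, hence divide N!; the other gaps are gaps of
-- level n, dividing the old offset and (being ≤ N) also N!.
offset-gap-∣ : ∀ n (i j : Fin (suc n)) → toℕ i < toℕ j → (offset n j ∸ offset n i) ∣ offset n i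
offset-gap-∣ (suc n) zero (suc j) _ =
  subst (_∣ bound n !) (sym (ℕP.m+n∸m≡n (bound n !) (offset n j))) (offset-∣-period n j)
offset-gap-∣ (suc n) (suc i) (suc j) (s≤s i<j) =
  subst (_∣ bound n ! +ℕ offset n i) (sym (ℕP.[m+n]∸[m+o]≡n∸o (bound n !) (offset n j) (offset n i)))
    (∣m∣n⇒∣m+n (∣n! (ℕP.m<n⇒0<n∸m (offset-mono n i j i<j)) gap≤bound) (offset-gap-∣ n i j i<j))
  where
  gap≤bound : offset n j ∸ offset n i ≤ bound n
  gap≤bound = ℕP.≤-trans (ℕP.m∸n≤m (offset n j) (offset n i)) (offset-≤-bound n j)

module Avoiding {k : ℕ} (φ : Colouring k) (avoid : ¬ HasAlmostMonoHomothet φ) where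

  forced : ∀ a t → 1 ≤ t → φ (a + + t) ≡ φ (a + + 2 * + t) → φ (a + + t) ≡ φ a
  forced a t 1≤t same with φ (a + + t) ≟ φ a
  ... | yes agree  = agree
  ... | no  differ = ⊥-elim (avoid (a , t , 1≤t , same , differ))

  descend : ∀ {d} → 1 ≤ d → ∀ m x → φ (x + + d) ≡ φ x → φ (x - + m * + d) ≡ φ x
  descend {d} _   zero    x _   = cong φ (sub-zero-multiple x (+ d))
  descend {d} 1≤d (suc m) x rep = begin
    φ (x - + suc m * + d)       ≡⟨ cong φ (step-back x (+ d) (+ m)) ⟩
    φ (x - + d - + m * + d)     ≡⟨ descend 1≤d m (x - + d) rep′ ⟩
    φ (x - + d)                 ≡⟨ previous ⟩
    φ x                         ∎
    where
    step-back : ∀ x d m → x - (+ 1 + m) * d ≡ x - d - m * d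
    step-back = solve-∀
    one-up : ∀ x d → x - d + d ≡ x
    one-up = solve-∀
    two-up : ∀ x d → x - d + + 2 * d ≡ x + d
    two-up = solve-∀
    -- at y = x - d both φ(y+d) and φ(y+2d) equal φ(x)
    previous : φ (x - + d) ≡ φ x
    previous = begin
      φ (x - + d)         ≡⟨ forced (x - + d) d 1≤d
                               (trans (cong φ (one-up x (+ d)))
                                 (trans (sym rep) (cong φ (sym (two-up x (+ d)))))) ⟨
      φ (x - + d + + d)   ≡⟨ cong φ (one-up x (+ d)) ⟩
      φ x                 ∎
    rep′ : φ (x - + d + + d) ≡ φ (x - + d)
    rep′ = trans (cong φ (one-up x (+ d))) (sym previous)

  descend-multiple : ∀ {d a} x → 1 ≤ d → d ∣ a → φ (x + + d) ≡ φ x → φ (x - + a) ≡ φ x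
  descend-multiple {d} x 1≤d (divides q refl) rep =
    subst (λ u → φ (x - u) ≡ φ x) (sym (ℤP.pos-* q d)) (descend 1≤d q x rep)

  recurrence : ∀ p → ∃ λ (i : Fin (suc k)) → φ (p + + offset k i) ≡ φ p
  recurrence p with FinP.pigeonhole (ℕP.n<1+n k) (λ i → φ (p + + offset k i))
  ... | i , j , i<j , same = i , (begin
    φ (p + + aᵢ)           ≡⟨ descend-multiple (p + + aᵢ) (ℕP.m<n⇒0<n∸m aᵢ<aⱼ)
                                (offset-gap-∣ k i j i<j) rep ⟨
    φ (p + + aᵢ - + aᵢ)    ≡⟨ cong φ (add-sub-cancel p (+ aᵢ)) ⟩
    φ p                    ∎)
    where
    aᵢ aⱼ : ℕ
    aᵢ = offset k i
    aⱼ = offset k j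
    aᵢ<aⱼ : aᵢ < aⱼ
    aᵢ<aⱼ = offset-mono k i j i<j
    rep : φ (p + + aᵢ + + (aⱼ ∸ aᵢ)) ≡ φ (p + + aᵢ)
    rep = trans (cong φ (trans (ℤP.+-assoc p (+ aᵢ) (+ (aⱼ ∸ aᵢ)))
                          (cong (λ u → p + + u) (ℕP.m+[n∸m]≡n (ℕP.<⇒≤ aᵢ<aⱼ)))))
                (sym same)

  period : ℕ
  period = bound k !

  -- φ(n + F) recurs at some offset aᵢ ∣ F above it; descending by F reaches n.
  periodic : Periodic φ period
  periodic n with recurrence (n + + period)
  ... | i , rec = begin
    φ (n + + period)              ≡⟨ descend-multiple (n + + period) (offset-pos k i)
                                       (offset-∣-period k i) rec ⟨
    φ (n + + period - + period)   ≡⟨ cong φ (add-sub-cancel n (+ period)) ⟩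
    φ n                           ∎

module PeriodicClasses {k : ℕ} (φ : Colouring k) (avoid : ¬ HasAlmostMonoHomothet φ)
                       (L′ : ℕ) (periodic : Periodic φ (suc L′)) where

  open Avoiding φ avoid using (descend)

  L : ℕ
  L = suc L′

  periodic-up : ∀ n m → φ (n + + m * + L) ≡ φ n
  periodic-up n zero    = cong φ (add-zero-multiple n (+ L))
  periodic-up n (suc m) = begin
    φ (n + + suc m * + L)       ≡⟨ cong φ (one-more n (+ m) (+ L)) ⟩
    φ (n + + m * + L + + L)     ≡⟨ periodic _ ⟩
    φ (n + + m * + L)           ≡⟨ periodic-up n m ⟩
    φ n                         ∎
    where
    one-more : ∀ n m l → n + (+ 1 + m) * l ≡ n + m * l + l
    one-more = solve-∀

  -- Downwards, periodicity is an instance of descend.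
  periodic-ℤ : ∀ n z → φ (n + z * + L) ≡ φ n
  periodic-ℤ n (+ m)     = periodic-up n m
  periodic-ℤ n -[1+ m ]  =
    trans (cong φ (add-negated n (+ suc m) (+ L))) (descend (s≤s z≤n) (suc m) n (periodic n))

  -- A repetition at distance d fills the whole line x + ℤd: to go up by md,
  -- descend by m·L′·d and then add the multiple md of the period L = L′ + 1.
  line : ∀ {d} x → 1 ≤ d → φ (x + + d) ≡ φ x → ∀ z → φ (x + z * + d) ≡ φ x
  line {d} x 1≤d rep -[1+ m ] =
    trans (cong φ (add-negated x (+ suc m) (+ d))) (descend 1≤d (suc m) x rep)
  line {d} x 1≤d rep (+ m) = begin
    φ (x + + m * + d)                  ≡⟨ cong φ (detour x (+ m) (+ L′) (+ d)) ⟨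
    φ (y + (+ m * + d) * + L)          ≡⟨ periodic-ℤ y (+ m * + d) ⟩
    φ y                                ≡⟨ cong (λ u → φ (x - u * + d)) (ℤP.pos-* m L′) ⟨
    φ (x - + (m *ℕ L′) * + d)          ≡⟨ descend 1≤d (m *ℕ L′) x rep ⟩
    φ x                                ∎
    where
    y : ℤ
    y = x - (+ m * + L′) * + d
    detour : ∀ x m l d → x - (m * l) * d + (m * d) * (+ 1 + l) ≡ x + m * d
    detour = solve-∀

  -- r is a step of colour c: two c-coloured points at distance r, the
  -- lower one in [0, L).  By periodicity this is decidable.
  Step : Fin k → ℕ → Set
  Step c r = ∃ λ y → y < L × φ (+ y) ≡ c × φ (+ y + + r) ≡ c

  to-step : ∀ c r w → φ w ≡ c → φ (w + + r) ≡ c → Step c r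
  to-step c r w ew ewr = w %ℕ L , n%ℕd<d w L , lower , upper
    where
    q : ℤ
    q = w /ℕ L
    split : w ≡ + (w %ℕ L) + q * + L
    split = a≡a%ℕn+[a/ℕn]*n w L
    swap : ∀ a b c → a + b + c ≡ a + c + b
    swap = solve-∀
    lower : φ (+ (w %ℕ L)) ≡ c
    lower = begin
      φ (+ (w %ℕ L))               ≡⟨ periodic-ℤ _ q ⟨
      φ (+ (w %ℕ L) + q * + L)     ≡⟨ cong φ split ⟨
      φ w                          ≡⟨ ew ⟩
      c                            ∎
    upper : φ (+ (w %ℕ L) + + r) ≡ c
    upper = begin
      φ (+ (w %ℕ L) + + r)              ≡⟨ periodic-ℤ _ q ⟨
      φ (+ (w %ℕ L) + + r + q * + L)    ≡⟨ cong φ (swap (+ (w %ℕ L)) (+ r) (q * + L)) ⟩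
      φ (+ (w %ℕ L) + q * + L + + r)    ≡⟨ cong (λ u → φ (u + + r)) split ⟨
      φ (w + + r)                       ≡⟨ ewr ⟩
      c                                 ∎

  SmallerStep : Fin k → ℕ → Set
  SmallerStep c s = ∃ λ r → r < s × 1 ≤ r × Step c r

  smaller-step? : ∀ c s → Dec (SmallerStep c s)
  smaller-step? c = ℕP.anyUpTo? (λ r → (1 ℕP.≤? r) ×-dec step? r)
    where
    step? : ∀ r → Dec (Step c r)
    step? r = ℕP.anyUpTo? (λ y → (φ (+ y) ≟ c) ×-dec (φ (+ y + + r) ≟ c)) L

  euclid-split : ∀ x m s → m ≡ x + ((m - x) /ℕ suc s) * + suc s + + ((m - x) %ℕ suc s)
  euclid-split x m s = begin
    m                                    ≡⟨ around x m ⟩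
    x + (m - x)                          ≡⟨ cong (λ u → x + u) (a≡a%ℕn+[a/ℕn]*n (m - x) (suc s)) ⟩
    x + (+ r + q * + suc s)              ≡⟨ regroup x (+ r) (q * + suc s) ⟩
    x + q * + suc s + + r                ∎
    where
    q : ℤ
    q = (m - x) /ℕ suc s
    r : ℕ
    r = (m - x) %ℕ suc s
    around : ∀ x m → m ≡ x + (m - x)
    around = solve-∀
    regroup : ∀ x r u → x + (r + u) ≡ x + u + r
    regroup = solve-∀

  -- A repetition of colour c at a distance s with no smaller step spans the
  -- whole class of c: any c-point off x + sℤ would give a step below s.
  minimal-step-AP : ∀ c x s → 1 ≤ s → φ x ≡ c → φ (x + + s) ≡ c → ¬ SmallerStep c s →
                    IsTwoWayAP (ColourClass φ c)
  minimal-step-AP c x (suc s) 1≤s ex exs none = x , suc s , 1≤s , λ m → mk⇔ (member m) (on-line m)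
    where
    on-line : ∀ m → (Σ ℤ λ i → m ≡ x + i * + suc s) → φ m ≡ c
    on-line _ (i , refl) = trans (line x 1≤s (trans exs (sym ex)) i) ex
    member : ∀ m → φ m ≡ c → Σ ℤ λ i → m ≡ x + i * + suc s
    member m em with (m - x) %ℕ suc s | n%ℕd<d (m - x) (suc s) | euclid-split x m s
    ... | zero  | _   | split = (m - x) /ℕ suc s , trans split (ℤP.+-identityʳ _)
    ... | suc r | r<s | split = ⊥-elim (none (suc r , r<s , s≤s z≤n ,
            to-step c (suc r) w (on-line w (q , refl)) (trans (cong φ (sym split)) em)))
      where
      q w : ℤ
      q = (m - x) /ℕ suc s
      w = x + q * + suc s

  -- Descending through ever smaller steps terminates at a minimal one.
  ClassFromStep : Fin k → ℕ → Set
  ClassFromStep c s = ∀ x → 1 ≤ s → φ x ≡ c → φ (x + + s) ≡ c → IsTwoWayAP (ColourClass φ c)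

  class-from-step : ∀ c s → ClassFromStep c s
  class-from-step c = <-rec (ClassFromStep c) descent
    where
    descent : ∀ s → (∀ {r} → r < s → ClassFromStep c r) → ClassFromStep c s
    descent s smaller x 1≤s ex exs with smaller-step? c s
    ... | yes (r , r<s , 1≤r , y , _ , ey , eyr) = smaller r<s (+ y) 1≤r ey eyr
    ... | no none                                = minimal-step-AP c x s 1≤s ex exs none

  -- Every attained colour starts with the repetition n, n + L.
  classes-are-APs : ∀ c → (Σ ℤ λ n → φ n ≡ c) → IsTwoWayAP (ColourClass φ c)
  classes-are-APs c (n , en) = class-from-step c L n (s≤s z≤n) en (trans (periodic n) en)

lemma4p1 : (k : ℕ) → Σ ℕ λ F → (1 ≤ F) ×
    ((φ : Colouring k) → ¬ HasAlmostMonoHomothet φ →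
      ((c : Fin k) → (Σ ℤ λ n → φ n ≡ c) → IsTwoWayAP (ColourClass φ c))
      × Periodic φ F)
lemma4p1 k = F , 1≤F , λ φ avoid →
  PeriodicClasses.classes-are-APs φ avoid (F ∸ 1) (periodic′ φ avoid) , Avoiding.periodic φ avoid
  where
  F : ℕ
  F = bound k !
  1≤F : 1 ≤ F
  1≤F = ℕP.1≤n! (bound k)
  -- the same period, written as the successor 1 + (F ∸ 1)
  periodic′ : (φ : Colouring k) → ¬ HasAlmostMonoHomothet φ → Periodic φ (suc (F ∸ 1))
  periodic′ φ avoid = subst (Periodic φ) (sym (ℕP.m+[n∸m]≡n 1≤F)) (Avoiding.periodic φ avoid)
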